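{- Let $p$ be a prime and let $(x[n])_{n \ge 1}$ be a periodic sequence over $GF(p)$. Let $S[n] = \sum_{k=1}^n x[k] \in GF(p)$ be its partial sums, each interpreted as an integer in $\{0,1,\dots,p-1\}$. The sequence $(S[n])_{n\ge1}$ is then periodic; let $P$ be its period, and suppose $P \not\equiv 0 \pmod p$. Then the series $\sum_{n\ge1} x[n]$ is Cesàro convergent over $GF(p)$. That is, the rational limit $\lim_{n\to\infty} \sigma_n$ of the Cesàro means $\sigma_n = \frac{1}{n}\sum_{k=1}^n S[k]$ exists and has a reduction modulo $p$ in $GF(p)$, namely $$\left(P \bmod p\right)^{ -1}\sum_{k=1}^P S[k] \pmod p.$$
   Context: A sequence $x$ is periodic with period $P$ if $x[n+P] = x[n]$ for all $n$. A series over $GF(p)$ is called Cesàro convergent to $\sigma$ if $\sigma = \lim_{n\to\infty}\sigma_n \pmod p$ is a well-defined element of $GF(p)$. The limit is taken first in $\mathbb{Q}$, with the $S[k]$ read as integers, and the resulting rational number $r/s$ is then mapped to $(r \bmod p)(s \bmod p)^{ -1} \in GF(p)$. -}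

module Defs where

open import Data.Nat as ℕ using (ℕ; zero; suc; _+_; _*_; _∸_; _^_; _%_; _≤_; _<_; NonZero)
open import Data.Nat.Divisibility using (_∣_)
open import Data.Fin using (Fin; toℕ)
open import Data.Integer as ℤ using (ℤ; +_; _%ℕ_)
open import Data.Rational as ℚ using (ℚ; ↥_; ↧ₙ_; 0ℚ; ∣_∣)
open import Data.Product using (Σ; ∃; _×_)
open import Relation.Nullary using (¬_)
open import Relation.Binary.PropositionalEquality using (_≡_)

sum1 : (ℕ → ℕ) → ℕ → ℕ
sum1 f zero    = 0
sum1 f (suc n) = sum1 f n + f (suc n)

-- sequences are indexed from 1; the value at index 0 is irrelevant
IsPeriod : {A : Set} → (ℕ → A) → ℕ → Set
IsPeriod f P = ∀ n → f (suc n + P) ≡ f (suc n)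

Periodic : {A : Set} → (ℕ → A) → Set
Periodic f = Σ ℕ λ P → (0 < P) × IsPeriod f P

IsMinimalPeriod : {A : Set} → (ℕ → A) → ℕ → Set
IsMinimalPeriod f P = (0 < P) × IsPeriod f P × (∀ Q → 0 < Q → Q < P → ¬ IsPeriod f Q)

partialSum : (p : ℕ) → .{{NonZero p}} → (ℕ → Fin p) → ℕ → ℕ
partialSum p x n = sum1 (λ k → toℕ (x k)) n % p

-- Cesàro means: cesaro S n = σ_{n+1} = (1/(n+1)) Σ_{k=1}^{n+1} S[k]  (in ℚ)
cesaro : (ℕ → ℕ) → ℕ → ℚ
cesaro S n = (+ sum1 S (suc n)) ℚ./ suc n

ConvergesTo : (ℕ → ℚ) → ℚ → Set
ConvergesTo a L = ∀ ε → 0ℚ ℚ.< ε → ∃ λ N → ∀ n → N ≤ n → ∣ a n ℚ.- L ∣ ℚ.< ε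

-- inverse in GF(p) (p prime), via Fermat: a⁻¹ = a^(p-2) mod p
invModP : (p : ℕ) → .{{NonZero p}} → ℕ → ℕ
invModP p a = (a ^ (p ∸ 2)) % p

-- a rational r/s (lowest terms) has a reduction mod p iff p ∤ s
HasReduction : ℕ → ℚ → Set
HasReduction p L = ¬ (p ∣ ↧ₙ L)

reduceModP : (p : ℕ) → .{{NonZero p}} → ℚ → ℕ
reduceModP p L = ((↥ L %ℕ p) * invModP p (↧ₙ L % p)) % p

CesaroConvergentTo : (p : ℕ) → .{{NonZero p}} → (ℕ → Fin p) → ℕ → Set
CesaroConvergentTo p x v =
  Σ ℚ λ L → ConvergesTo (cesaro (partialSum p x)) L × HasReduction p L × reduceModP p L ≡ v

module Submission where

-- Let S be the sequence of partial sums, with period P, and T = Σ_{k≤P} S[k].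
-- Writing N = r + qP with r < P, periodicity gives Σ_{k≤N} S[k] = qT + Σ_{k≤r} S[k],
-- so |P · Σ_{k≤N} S[k] − T · N| stays bounded; dividing by N P, the Cesàro means
-- converge to the rational T / P.  For its value mod p, write T / P in lowest
-- terms r / s with T = r g and P = s g.  Since p ∤ P, p ∤ s (so the reduction
-- exists) and p ∤ g, and Fermat's little theorem g^{p-1} ≡ 1 turns
-- r s^{p-2} into P^{p-2} T: the reduction is P⁻¹ T with the Fermat inverse.

open import Defs
open import Data.Nat using (ℕ; NonZero; _*_; _%_)
open import Data.Nat.Divisibility using (_∣_)
open import Data.Nat.Primality using (Prime)
open import Data.Fin using (Fin)
open import Relation.Nullary using (¬_)

open import Data.Nat using (zero; suc; _+_; _∸_; _^_; _!; _≤_; _<_; _⊔_; ∣_-_∣; z≤n; s≤s; nonTrivial⇒n>1; >-nonZero)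
open import Data.Nat.Properties
open import Data.Nat.DivMod
open import Data.Nat.Divisibility using (divides; _∣0; ∣m∣n⇒∣m+n; m∣m*n; ∣m⇒∣m*n; ∣n⇒∣m*n; ∣⇒≤)
open import Data.Nat.Primality using (euclidsLemma)
open import Data.Nat.Combinatorics using (_C_; nCk≡n!/k![n-k]!; k![n∸k]!∣n!; nCn≡1)
open import Data.Fin using (zero; suc; toℕ; fromℕ; inject₁)
open import Data.Fin.Properties using (toℕ-fromℕ; toℕ-inject₁; toℕ<n)
open import Data.Nat.GCD using (gcd)
open import Data.Nat.Tactic.RingSolver using (solve-∀)
open import Data.Product using (_×_; _,_; proj₁; proj₂)
open import Data.Sum using (inj₁; inj₂)
import Data.Integer as ℤ
import Data.Integer.Properties as ℤP
open ℤ using (ℤ) renaming (+_ to pos)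
import Data.Rational as ℚ
import Data.Rational.Properties as ℚP
import Data.Rational.Unnormalised as ℚᵘ
import Data.Rational.Unnormalised.Properties as ℚᵘP
open ℚᵘ using (mkℚᵘ)
open import Relation.Nullary using (contradiction)
open import Relation.Binary.PropositionalEquality
open import Algebra.Bundles using (CommutativeSemiring)
import Algebra.Properties.CommutativeSemiring.Binomial as Binomial
import Algebra.Properties.CommutativeSemiring.Exp as Exp

open CommutativeSemiring +-*-commutativeSemiring using (semiring)
open import Algebra.Properties.Semiring.Mult semiring using () renaming (_×_ to _×ₛ_)
open import Algebra.Properties.Semiring.Exp semiring using () renaming (_^_ to _^ₛ_)
open import Algebra.Properties.Semiring.Sum semiring using (sum; sum-init-last)
open Binomial +-*-commutativeSemiring using (binomialTerm) renaming (theorem to binomialTheorem)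

×ₛ≡* : ∀ n x → n ×ₛ x ≡ n * x
×ₛ≡* zero    x = refl
×ₛ≡* (suc n) x = cong (x +_) (×ₛ≡* n x)

^ₛ≡^ : ∀ x n → x ^ₛ n ≡ x ^ n
^ₛ≡^ x zero    = refl
^ₛ≡^ x (suc n) = cong (x *_) (^ₛ≡^ x n)

^-distrib-* : ∀ x y n → (x * y) ^ n ≡ x ^ n * y ^ n
^-distrib-* x y n = begin
  (x * y) ^ n      ≡⟨ ^ₛ≡^ (x * y) n ⟨
  (x * y) ^ₛ n     ≡⟨ Exp.^-distrib-* +-*-commutativeSemiring x y n ⟩
  x ^ₛ n * y ^ₛ n  ≡⟨ cong₂ _*_ (^ₛ≡^ x n) (^ₛ≡^ y n) ⟩
  x ^ n * y ^ n    ∎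
  where open ≡-Reasoning

∣-sum : ∀ {d n} (t : Fin n → ℕ) → (∀ i → d ∣ t i) → d ∣ sum t
∣-sum {d} {zero}  t d∣t = d ∣0
∣-sum {d} {suc n} t d∣t = ∣m∣n⇒∣m+n (d∣t zero) (∣-sum (λ i → t (suc i)) (λ i → d∣t (suc i)))

binomialTerm-+1 : ∀ a n (i : Fin (suc n)) → binomialTerm a 1 n i ≡ (n C toℕ i) * a ^ toℕ i
binomialTerm-+1 a n i = begin
  (n C k) ×ₛ (a ^ₛ k * 1 ^ₛ (n ∸ k)) ≡⟨ ×ₛ≡* (n C k) _ ⟩
  (n C k) * (a ^ₛ k * 1 ^ₛ (n ∸ k))  ≡⟨ cong₂ (λ u v → (n C k) * (u * v)) (^ₛ≡^ a k) 1^ₛ≡1 ⟩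
  (n C k) * (a ^ k * 1)             ≡⟨ cong ((n C k) *_) (*-identityʳ (a ^ k)) ⟩
  (n C k) * a ^ k                   ∎
  where
  open ≡-Reasoning
  k = toℕ i
  1^ₛ≡1 = trans (^ₛ≡^ 1 (n ∸ k)) (^-zeroˡ (n ∸ k))

+-cong-mod : ∀ {a a′ b} d .{{_ : NonZero d}} → a % d ≡ a′ % d → (a + b) % d ≡ (a′ + b) % d
+-cong-mod {a} {a′} {b} d eq = begin
  (a + b) % d               ≡⟨ %-distribˡ-+ a b d ⟩
  ((a % d) + (b % d)) % d   ≡⟨ cong (λ u → (u + b % d) % d) eq ⟩
  ((a′ % d) + (b % d)) % d  ≡⟨ %-distribˡ-+ a′ b d ⟨
  (a′ + b) % d              ∎
  where open ≡-Reasoning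

*-cong-mod : ∀ d .{{_ : NonZero d}} {a a′ b b′} →
             a % d ≡ a′ % d → b % d ≡ b′ % d → (a * b) % d ≡ (a′ * b′) % d
*-cong-mod d {a} {a′} {b} {b′} eqa eqb = begin
  (a * b) % d                ≡⟨ %-distribˡ-* a b d ⟩
  ((a % d) * (b % d)) % d    ≡⟨ cong₂ (λ u v → (u * v) % d) eqa eqb ⟩
  ((a′ % d) * (b′ % d)) % d  ≡⟨ %-distribˡ-* a′ b′ d ⟨
  (a′ * b′) % d              ∎
  where open ≡-Reasoning

^-cong-mod : ∀ {a a′} d .{{_ : NonZero d}} → a % d ≡ a′ % d → ∀ n → (a ^ n) % d ≡ (a′ ^ n) % d
^-cong-mod d eq zero    = refl
^-cong-mod d eq (suc n) = *-cong-mod d eq (^-cong-mod d eq n)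

*-unitʳ-mod : ∀ d .{{_ : NonZero d}} a u → u % d ≡ 1 % d → (a * u) % d ≡ a % d
*-unitʳ-mod d a u u≡1 = trans (*-cong-mod d {a} {a} {u} {1} refl u≡1) (cong (_% d) (*-identityʳ a))

≡-mod⇒∣∸ : ∀ {m n} d .{{_ : NonZero d}} → n ≤ m → m % d ≡ n % d → d ∣ m ∸ n
≡-mod⇒∣∸ {m} {n} d n≤m eq = divides (m / d ∸ n / d) (begin
  m ∸ n                                    ≡⟨ cong₂ _∸_ (m≡m%n+[m/n]*n m d) (m≡m%n+[m/n]*n n d) ⟩
  (m % d + m / d * d) ∸ (n % d + n / d * d) ≡⟨ cong (λ u → (m % d + m / d * d) ∸ (u + n / d * d)) eq ⟨
  (m % d + m / d * d) ∸ (m % d + n / d * d) ≡⟨ [m+n]∸[m+o]≡n∸o (m % d) _ _ ⟩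
  m / d * d ∸ n / d * d                    ≡⟨ *-distribʳ-∸ d (m / d) (n / d) ⟨
  (m / d ∸ n / d) * d                      ∎)
  where open ≡-Reasoning

∣∸⇒≡-mod : ∀ {m n} d .{{_ : NonZero d}} → n ≤ m → d ∣ m ∸ n → m % d ≡ n % d
∣∸⇒≡-mod {m} {n} d n≤m d∣m∸n = begin
  m % d             ≡⟨ cong (_% d) (m+[n∸m]≡n n≤m) ⟨
  (n + (m ∸ n)) % d ≡⟨ %-remove-+ʳ n d∣m∸n ⟩
  n % d             ∎
  where open ≡-Reasoning

-- A prime does not divide m! for m < p: every factor of m! is below p.
prime∤factorial : ∀ {p m} → Prime p → m < p → ¬ p ∣ m !
prime∤factorial {p} {zero}  pr _   p∣1  = <⇒≱ (nonTrivial⇒n>1 p) (∣⇒≤ p∣1)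
  where open Prime pr
prime∤factorial {p} {suc m} pr m<p p∣m! with euclidsLemma (suc m) (m !) pr p∣m!
... | inj₁ p∣1+m = <⇒≱ m<p (∣⇒≤ p∣1+m)
... | inj₂ p∣m!  = prime∤factorial pr (<-trans (n<1+n m) m<p) p∣m!

binomial-factorials : ∀ {n k} → k ≤ n → (n C k) * (k ! * (n ∸ k) !) ≡ n !
binomial-factorials {n} {k} k≤n = begin
  (n C k) * (k ! * (n ∸ k) !)                  ≡⟨ cong (_* (k ! * (n ∸ k) !)) (nCk≡n!/k![n-k]! k≤n) ⟩
  (n ! / (k ! * (n ∸ k) !)) * (k ! * (n ∸ k) !) ≡⟨ m/n*n≡m (k![n∸k]!∣n! k≤n) ⟩
  n !                                          ∎
  where
  open ≡-Reasoning
  instance _ = k !* (n ∸ k) !≢0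

-- p divides p C j for 0 < j < p: p divides p! = (p C j) · j! (p-j)! but
-- neither factorial.
prime∣binomial : ∀ {p j} → Prime p → 0 < j → j < p → p ∣ p C j
prime∣binomial {p@(suc m)} {j} pr 0<j j<p
  with euclidsLemma (p C j) (j ! * (p ∸ j) !) pr (subst (p ∣_) (sym (binomial-factorials (<⇒≤ j<p))) (m∣m*n (m !)))
... | inj₁ p∣C = p∣C
... | inj₂ p∣j![p-j]! with euclidsLemma (j !) ((p ∸ j) !) pr p∣j![p-j]!
...   | inj₁ p∣j!     = contradiction p∣j! (prime∤factorial pr j<p)
...   | inj₂ p∣[p-j]! = contradiction p∣[p-j]! (prime∤factorial pr (∸-monoʳ-< 0<j (<⇒≤ j<p)))

-- Freshman's dream: (a + 1)ᵖ ≡ aᵖ + 1 (mod p), as all inner binomial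
-- coefficients vanish mod p.
freshman : ∀ {p} .{{_ : NonZero p}} → Prime p → ∀ a → (a + 1) ^ p % p ≡ (a ^ p + 1) % p
freshman {p@(suc m)} pr a = begin
  (a + 1) ^ p % p                          ≡⟨ cong (_% p) expand ⟩
  (t zero + (inner + t (fromℕ p))) % p     ≡⟨ cong (_% p) (rearrange (t zero) inner (t (fromℕ p))) ⟩
  (inner + (t (fromℕ p) + t zero)) % p     ≡⟨ %-remove-+ˡ _ p∣inner ⟩
  (t (fromℕ p) + t zero) % p               ≡⟨ cong₂ (λ u v → (u + v) % p) last≡aᵖ first≡1 ⟩
  (a ^ p + 1) % p                          ∎
  where
  open ≡-Reasoning
  t = binomialTerm a 1 p
  inner = sum (λ (i : Fin m) → t (suc (inject₁ i)))
  expand : (a + 1) ^ p ≡ t zero + (inner + t (fromℕ p))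
  expand = trans (sym (^ₛ≡^ (a + 1) p))
                 (trans (binomialTheorem p a 1) (cong (t zero +_) (sum-init-last (λ i → t (suc i)))))
  first≡1 : t zero ≡ 1
  first≡1 = binomialTerm-+1 a p zero
  last≡aᵖ : t (fromℕ p) ≡ a ^ p
  last≡aᵖ = begin
    t (fromℕ p)                             ≡⟨ binomialTerm-+1 a p (fromℕ p) ⟩
    (p C toℕ (fromℕ p)) * a ^ toℕ (fromℕ p) ≡⟨ cong (λ k → (p C k) * a ^ k) (toℕ-fromℕ p) ⟩
    (p C p) * a ^ p                         ≡⟨ cong (_* a ^ p) (nCn≡1 p) ⟩
    1 * a ^ p                               ≡⟨ *-identityˡ (a ^ p) ⟩
    a ^ p                                   ∎
  p∣inner : p ∣ inner
  p∣inner = ∣-sum _ λ i → subst (p ∣_) (sym (binomialTerm-+1 a p (suc (inject₁ i))))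
    (∣m⇒∣m*n _ (prime∣binomial pr (s≤s z≤n) (s≤s (subst (_< m) (sym (toℕ-inject₁ i)) (toℕ<n i)))))
  rearrange : ∀ x y z → x + (y + z) ≡ y + (z + x)
  rearrange x y z = trans (+-comm x (y + z)) (+-assoc y z x)

fermat-pow : ∀ {p} .{{_ : NonZero p}} → Prime p → ∀ a → a ^ p % p ≡ a % p
fermat-pow {suc m} pr zero    = refl
fermat-pow {p}     pr (suc a) = begin
  suc a ^ p % p    ≡⟨ cong (λ b → b ^ p % p) (+-comm 1 a) ⟩
  (a + 1) ^ p % p  ≡⟨ freshman pr a ⟩
  (a ^ p + 1) % p  ≡⟨ +-cong-mod p (fermat-pow pr a) ⟩
  (a + 1) % p      ≡⟨ cong (_% p) (+-comm a 1) ⟩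
  suc a % p        ∎
  where open ≡-Reasoning

-- Fermat's little theorem: aᵖ⁻¹ ≡ 1 (mod p) when p ∤ a, cancelling a
-- from aᵖ ≡ a.
fermat : ∀ {p} .{{_ : NonZero p}} → Prime p → ∀ {a} → ¬ p ∣ a → a ^ (p ∸ 1) % p ≡ 1 % p
fermat {p@(suc m)} pr {zero}  p∤a = contradiction (p ∣0) p∤a
fermat {p@(suc m)} pr {a@(suc _)} p∤a with euclidsLemma a (a ^ m ∸ 1) pr p∣a[aᵐ-1]
  where
  1≤aᵐ = m^n>0 a m
  p∣a[aᵐ-1] : p ∣ a * (a ^ m ∸ 1)
  p∣a[aᵐ-1] = subst (p ∣_) (sym (*-distribˡ-∸ a (a ^ m) 1))
    (≡-mod⇒∣∸ p (*-monoʳ-≤ a 1≤aᵐ) (trans (fermat-pow pr a) (cong (_% p) (sym (*-identityʳ a)))))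
... | inj₁ p∣a     = contradiction p∣a p∤a
... | inj₂ p∣aᵐ-1 = ∣∸⇒≡-mod p (m^n>0 a m) p∣aᵐ-1

-- Cancelling a common factor g of T = r g and P = s g modulo p ∤ P:
-- r sᵖ⁻² ≡ Pᵖ⁻² T, since the extra factor gᵖ⁻¹ is 1 by Fermat.
cancel-common-factor : ∀ {p} .{{_ : NonZero p}} → Prime p → ∀ r s g {T P} →
  r * g ≡ T → s * g ≡ P → ¬ p ∣ P → (r * s ^ (p ∸ 2)) % p ≡ (P ^ (p ∸ 2) * T) % p
cancel-common-factor {p@(suc (suc k))} pr r s g refl refl p∤P = begin
  (r * s ^ k) % p                   ≡⟨ *-unitʳ-mod p (r * s ^ k) (g ^ suc k) (fermat pr p∤g) ⟨
  (r * s ^ k * (g * g ^ k)) % p     ≡⟨ cong (_% p) (regroup r (s ^ k) g (g ^ k)) ⟩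
  (s ^ k * g ^ k * (r * g)) % p     ≡⟨ cong (λ u → (u * (r * g)) % p) (^-distrib-* s g k) ⟨
  ((s * g) ^ k * (r * g)) % p       ∎
  where
  open ≡-Reasoning
  p∤g : ¬ p ∣ g
  p∤g p∣g = p∤P (∣n⇒∣m*n s p∣g)
  regroup : ∀ r x g y → r * x * (g * y) ≡ x * y * (r * g)
  regroup = solve-∀

nonNeg⇒↥≡∣↥∣ : ∀ q → .{{ℚ.NonNegative q}} → ℚ.↥ q ≡ pos ℤ.∣ ℚ.↥ q ∣
nonNeg⇒↥≡∣↥∣ (ℚ.mkℚ (pos n) _ _) = refl

lowest-terms : ∀ T P .{{_ : NonZero P}} → let q = pos T ℚ./ P in
  ℚ.↥ q ≡ pos ℤ.∣ ℚ.↥ q ∣ × ℤ.∣ ℚ.↥ q ∣ * gcd T P ≡ T × ℚ.↧ₙ q * gcd T P ≡ P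
lowest-terms T P = nonNeg⇒↥≡∣↥∣ q {{ℚP.normalize-nonNeg T P}} , numerator , denominator
  where
  q = pos T ℚ./ P
  numerator = trans (sym (ℤP.abs-* (ℚ.↥ q) (pos (gcd T P)))) (cong ℤ.∣_∣ (ℚP.↥-/ (pos T) P))
  denominator = ℤP.+-injective (trans (ℤP.pos-* (ℚ.↧ₙ q) (gcd T P)) (ℚP.↧-/ (pos T) P))

fraction-reduction : ∀ {p} .{{_ : NonZero p}} → Prime p → ∀ T P .{{_ : NonZero P}} → ¬ p ∣ P →
  HasReduction p (pos T ℚ./ P) × reduceModP p (pos T ℚ./ P) ≡ (invModP p (P % p) * (T % p)) % p
fraction-reduction {p} pr T P p∤P = p∤s , (begin
  ((ℚ.↥ q ℤ.%ℕ p) * invModP p (s % p)) % p   ≡⟨ cong (λ i → ((i ℤ.%ℕ p) * invModP p (s % p)) % p) ↥q≡r ⟩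
  ((r % p) * ((s % p) ^ (p ∸ 2) % p)) % p    ≡⟨ *-cong-mod p (m%n%n≡m%n r p) (reduce-power s) ⟩
  (r * s ^ (p ∸ 2)) % p                      ≡⟨ cancel-common-factor pr r s (gcd T P) rg≡T sg≡P p∤P ⟩
  (P ^ (p ∸ 2) * T) % p                      ≡⟨ *-cong-mod p (sym (reduce-power P)) (sym (m%n%n≡m%n T p)) ⟩
  (invModP p (P % p) * (T % p)) % p          ∎)
  where
  open ≡-Reasoning
  q = pos T ℚ./ P
  r = ℤ.∣ ℚ.↥ q ∣
  s = ℚ.↧ₙ q
  ↥q≡r : ℚ.↥ q ≡ pos r
  ↥q≡r = proj₁ (lowest-terms T P)
  rg≡T : r * gcd T P ≡ T
  rg≡T = proj₁ (proj₂ (lowest-terms T P))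
  sg≡P : s * gcd T P ≡ P
  sg≡P = proj₂ (proj₂ (lowest-terms T P))
  p∤s : ¬ p ∣ s
  p∤s p∣s = p∤P (subst (p ∣_) sg≡P (∣m⇒∣m*n (gcd T P) p∣s))
  reduce-power : ∀ a → ((a % p) ^ (p ∸ 2) % p) % p ≡ (a ^ (p ∸ 2)) % p
  reduce-power a = trans (m%n%n≡m%n _ p) (^-cong-mod p (m%n%n≡m%n a p) (p ∸ 2))

sum1-bound : ∀ {f c} → (∀ k → f k ≤ c) → ∀ n → sum1 f n ≤ n * c
sum1-bound f≤c zero    = z≤n
sum1-bound {f} {c} f≤c (suc n) = begin
  sum1 f n + f (suc n) ≤⟨ +-mono-≤ (sum1-bound f≤c n) (f≤c (suc n)) ⟩
  n * c + c            ≡⟨ +-comm (n * c) c ⟩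
  suc n * c            ∎
  where open ≤-Reasoning

module _ (S : ℕ → ℕ) {P : ℕ} (period : IsPeriod S P) where

  sum1-shift : ∀ n → sum1 S (P + n) ≡ sum1 S P + sum1 S n
  sum1-shift zero    = trans (cong (sum1 S) (+-identityʳ P)) (sym (+-identityʳ (sum1 S P)))
  sum1-shift (suc n) = begin
    sum1 S (P + suc n)                         ≡⟨ cong (sum1 S) (+-suc P n) ⟩
    sum1 S (P + n) + S (suc (P + n))           ≡⟨ cong₂ _+_ (sum1-shift n) shifted-term ⟩
    sum1 S P + sum1 S n + S (suc n)            ≡⟨ +-assoc (sum1 S P) (sum1 S n) (S (suc n)) ⟩
    sum1 S P + (sum1 S n + S (suc n))          ∎
    where
    open ≡-Reasoning
    shifted-term : S (suc (P + n)) ≡ S (suc n)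
    shifted-term = trans (cong (λ m → S (suc m)) (+-comm P n)) (period n)

  sum1-periods : ∀ q r → sum1 S (r + q * P) ≡ q * sum1 S P + sum1 S r
  sum1-periods zero    r = cong (sum1 S) (+-identityʳ r)
  sum1-periods (suc q) r = begin
    sum1 S (r + (P + q * P))              ≡⟨ cong (sum1 S) (x+[y+z]≡y+[x+z] r P (q * P)) ⟩
    sum1 S (P + (r + q * P))              ≡⟨ sum1-shift (r + q * P) ⟩
    sum1 S P + sum1 S (r + q * P)         ≡⟨ cong (sum1 S P +_) (sum1-periods q r) ⟩
    sum1 S P + (q * sum1 S P + sum1 S r)  ≡⟨ +-assoc (sum1 S P) (q * sum1 S P) (sum1 S r) ⟨
    suc q * sum1 S P + sum1 S r           ∎
    where
    open ≡-Reasoning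
    x+[y+z]≡y+[x+z] : ∀ x y z → x + (y + z) ≡ y + (x + z)
    x+[y+z]≡y+[x+z] = solve-∀

  periodic-discrepancy : ∀ {c} → (∀ k → S k ≤ c) → .{{_ : NonZero P}} →
    ∀ N → ∣ sum1 S N * P - sum1 S P * N ∣ ≤ P * c * P ⊔ sum1 S P * P
  periodic-discrepancy {c} S≤c N = begin
    ∣ sum1 S N * P - T * N ∣                              ≡⟨ cong (λ M → ∣ sum1 S M * P - T * M ∣) N≡r+qP ⟩
    ∣ sum1 S (r + q * P) * P - T * (r + q * P) ∣          ≡⟨ cong (λ x → ∣ x * P - T * (r + q * P) ∣) (sum1-periods q r) ⟩
    ∣ (q * T + sum1 S r) * P - T * (r + q * P) ∣          ≡⟨ cong₂ ∣_-_∣ (split₁ q T (sum1 S r) P) (split₂ q T r P) ⟩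
    ∣ q * T * P + sum1 S r * P - q * T * P + T * r ∣      ≡⟨ ∣m+n-m+o∣≡∣n-o∣ (q * T * P) _ _ ⟩
    ∣ sum1 S r * P - T * r ∣                              ≤⟨ ∣m-n∣≤m⊔n (sum1 S r * P) (T * r) ⟩
    sum1 S r * P ⊔ T * r                                  ≤⟨ ⊔-mono-≤ (*-monoˡ-≤ P Σr≤Pc) (*-monoʳ-≤ T r≤P) ⟩
    P * c * P ⊔ T * P                                     ∎
    where
    open ≤-Reasoning
    T = sum1 S P
    r = N % P
    q = N / P
    N≡r+qP = m≡m%n+[m/n]*n N P
    r≤P = <⇒≤ (m%n<n N P)
    Σr≤Pc : sum1 S r ≤ P * c
    Σr≤Pc = ≤-trans (sum1-bound S≤c r) (*-monoˡ-≤ c r≤P)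
    split₁ : ∀ q T s P → (q * T + s) * P ≡ q * T * P + s * P
    split₁ = solve-∀
    split₂ : ∀ q T r P → T * (r + q * P) ≡ q * T * P + T * r
    split₂ = solve-∀

∣pos-pos∣ : ∀ a b → ℤ.∣ pos a ℤ.- pos b ∣ ≡ ∣ a - b ∣
∣pos-pos∣ a b with ≤-total a b
... | inj₁ a≤b = begin
  ℤ.∣ pos a ℤ.- pos b ∣ ≡⟨ cong ℤ.∣_∣ (ℤP.m-n≡m⊖n a b) ⟩
  ℤ.∣ a ℤ.⊖ b ∣         ≡⟨ ℤP.∣⊖∣-≤ a≤b ⟩
  b ∸ a                 ≡⟨ m≤n⇒∣m-n∣≡n∸m a≤b ⟨
  ∣ a - b ∣             ∎
  where open ≡-Reasoning
... | inj₂ b≤a = begin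
  ℤ.∣ pos a ℤ.- pos b ∣ ≡⟨ cong ℤ.∣_∣ (trans (ℤP.m-n≡m⊖n a b) (ℤP.⊖-≥ b≤a)) ⟩
  a ∸ b                 ≡⟨ m≤n⇒∣n-m∣≡n∸m b≤a ⟨
  ∣ a - b ∣             ∎
  where open ≡-Reasoning

toℚᵘ-∣/-/∣ : ∀ i n j m → ℚ.toℚᵘ ℚ.∣ i ℚ./ suc n ℚ.- j ℚ./ suc m ∣ ℚᵘ.≃ ℚᵘ.∣ mkℚᵘ i n ℚᵘ.- mkℚᵘ j m ∣
toℚᵘ-∣/-/∣ i n j m =
  ℚᵘP.≃-trans (ℚP.toℚᵘ-homo-∣-∣ (x ℚ.- y)) (ℚᵘP.∣-∣-cong
    (ℚᵘP.≃-trans (ℚP.toℚᵘ-homo-+ x (ℚ.- y))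
      (ℚᵘP.+-cong (ℚP.toℚᵘ-fromℚᵘ (mkℚᵘ i n))
        (ℚᵘP.≃-trans (ℚP.toℚᵘ-homo‿- y) (ℚᵘP.-‿cong (ℚP.toℚᵘ-fromℚᵘ (mkℚᵘ j m)))))))
  where
  x = i ℚ./ suc n
  y = j ℚ./ suc m

-- If a(n) stays within bounded distance of the linear function
-- (n+1) T / P, then a(n) / (n+1) converges to T / P: the error is at most
-- B / ((n+1) P).
discrepancy⇒convergence : ∀ (a : ℕ → ℕ) T P B .{{_ : NonZero P}} →
  (∀ n → ∣ a n * P - T * suc n ∣ ≤ B) → ConvergesTo (λ n → pos (a n) ℚ./ suc n) (pos T ℚ./ P)
discrepancy⇒convergence a T P@(suc P′) B bounded (ℚ.mkℚ (pos (suc e)) d _) _ =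
  B * suc d , λ n B[1+d]≤n → ℚP.toℚᵘ-cancel-<
    (ℚᵘP.<-respˡ-≃ (ℚᵘP.≃-sym (toℚᵘ-∣/-/∣ (pos (a n)) n (pos T) P′)) (error<ε n B[1+d]≤n))
  where
  numerator : ℕ → ℤ
  numerator n = pos (a n) ℤ.* pos P ℤ.+ ℤ.- pos T ℤ.* pos (suc n)
  ∣numerator∣ : ∀ n → ℤ.∣ numerator n ∣ ≡ ∣ a n * P - T * suc n ∣
  ∣numerator∣ n = trans (cong ℤ.∣_∣ (cong₂ ℤ._+_ (sym (ℤP.pos-* (a n) P)) negated))
                        (∣pos-pos∣ (a n * P) (T * suc n))
    where
    negated : ℤ.- pos T ℤ.* pos (suc n) ≡ ℤ.- pos (T * suc n)
    negated = trans (sym (ℤP.neg-distribˡ-* (pos T) (pos (suc n)))) (cong ℤ.-_ (sym (ℤP.pos-* T (suc n))))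
  error<ε : ∀ n → B * suc d ≤ n → ℚᵘ.∣ mkℚᵘ (pos (a n)) n ℚᵘ.- mkℚᵘ (pos T) P′ ∣ ℚᵘ.< mkℚᵘ (pos (suc e)) d
  error<ε n B[1+d]≤n =
    ℚᵘ.*<* (subst₂ ℤ._<_ (ℤP.pos-* ℤ.∣ numerator n ∣ (suc d)) (ℤP.pos-* (suc e) (suc n * P)) (ℤ.+<+ cross))
    where
    open ≤-Reasoning
    cross : ℤ.∣ numerator n ∣ * suc d < suc e * (suc n * P)
    cross = begin-strict
      ℤ.∣ numerator n ∣ * suc d        ≡⟨ cong (_* suc d) (∣numerator∣ n) ⟩
      ∣ a n * P - T * suc n ∣ * suc d  ≤⟨ *-monoˡ-≤ (suc d) (bounded n) ⟩
      B * suc d                        ≤⟨ B[1+d]≤n ⟩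
      n                                <⟨ n<1+n n ⟩
      suc n                            ≤⟨ m≤m*n (suc n) P ⟩
      suc n * P                        ≤⟨ m≤n*m (suc n * P) (suc e) ⟩
      suc e * (suc n * P)              ∎
discrepancy⇒convergence a T P B bounded (ℚ.mkℚ (pos zero) d _) (ℚ.*<* (ℤ.+<+ ()))
discrepancy⇒convergence a T P B bounded (ℚ.mkℚ ℤ.-[1+ _ ] d _) (ℚ.*<* ())

corollary1 : (p : ℕ) → .{{_ : NonZero p}} → Prime p →
    (x : ℕ → Fin p) → Periodic x →
    (P : ℕ) → IsMinimalPeriod (partialSum p x) P → ¬ (p ∣ P) →
    CesaroConvergentTo p x ((invModP p (P % p) * (sum1 (partialSum p x) P % p)) % p)
corollary1 p pr x _ P (0<P , period , _) p∤P = pos T ℚ./ P , convergence , fraction-reduction pr T P p∤P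
  where
  instance
    P≢0 : NonZero P
    P≢0 = >-nonZero 0<P
  S = partialSum p x
  T = sum1 S P
  S≤p : ∀ k → S k ≤ p
  S≤p k = m%n≤n (sum1 (λ i → toℕ (x i)) k) p
  convergence : ConvergesTo (cesaro S) (pos T ℚ./ P)
  convergence = discrepancy⇒convergence (λ n → sum1 S (suc n)) T P (P * p * P ⊔ T * P)
                  (λ n → periodic-discrepancy S period S≤p (suc n))
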